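{- Let $\mathbf{P}$ denote the set of prime numbers and let $\mathbf{X}=(\mathbf{N},\tau)$ be the topological space defined in the context. Then $\mathbf{P}$ is infinite (i.e. $\#\mathbf{P}=\aleph_0$) if and only if $\mathbf{P}$ is dense in $\mathbf{X}$.
   Context: $\mathbf{N}$ denotes the set of positive integers. For $n\in\mathbf{N}$ let $\sigma_n=\{m\in\mathbf{N}:\gcd(n,m)=1\}$. The family $\{\sigma_n:n\in\mathbf{N}\}$ is a base for a topology $\tau$ on $\mathbf{N}$, and $\mathbf{X}=(\mathbf{N},\tau)$. $\aleph_0=\#\mathbf{N}$. -}

module Defs where

open import Level using (0ℓ)
open import Data.Nat using (ℕ; _≤_)
open import Data.Nat.GCD using (gcd)
open import Data.Nat.Primality using (Prime)
open import Data.Product using (Σ; _×_; ∃)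
open import Data.List using (List)
open import Data.List.Membership.Propositional using (_∈_)
open import Relation.Nullary using (¬_)
open import Relation.Unary using (Pred)
open import Relation.Binary.PropositionalEquality using (_≡_)

-- Subsets of ℕ as predicates.  The carrier of X is the set of POSITIVE integers
-- {m : ℕ ∣ 1 ≤ m}; subsets of X are predicates contained in it.
Subset : Set₁
Subset = Pred ℕ 0ℓ

Pos : Subset
Pos m = 1 ≤ m

σ : ℕ → Subset
σ n m = (1 ≤ m) × (gcd n m ≡ 1)

-- Open sets of τ: the topology generated by the base {σ n : n ∈ 𝐍}, i.e.
-- unions of basic sets: U ⊆ 𝐍 and every point of U lies in some σ n ⊆ U.
IsOpen : Subset → Set
IsOpen U = (∀ {x} → U x → Pos x)
         × (∀ {x} → U x → Σ ℕ λ n → (1 ≤ n) × σ n x × (∀ {y} → σ n y → U y))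

Dense : Subset → Set₁
Dense A = (∀ {x} → A x → Pos x)
        × ((U : Subset) → IsOpen U → (∃ λ x → U x) → ∃ λ x → U x × A x)

𝐏 : Subset
𝐏 = Prime

Finite : Subset → Set
Finite A = Σ (List ℕ) λ xs → ∀ {x} → A x → x ∈ xs

Infinite : Subset → Set
Infinite A = ¬ Finite A

-- Every basic open set σ n (n ≥ 1) contains a prime, namely any prime factor of n + 1, so the
-- primes are dense whether or not there are infinitely many of them.  Conversely, if the primes
-- were p₁, …, pₖ, the nonempty open set σ (p₁ ⋯ pₖ) would contain no prime.
module Submission where

open import Defs
open import Data.Empty using (⊥; ⊥-elim)
open import Data.List using (filter; []; _∷_)
open import Data.List.Relation.Unary.Any using (here)
open import Data.List.Membership.Propositional.Properties using (∈-filter⁺)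
open import Data.List.Relation.Unary.All using (_∷_)
open import Data.List.Relation.Unary.All.Properties using (all-filter)
open import Data.Nat using (zero; suc; _≤_; s≤s; z≤n; >-nonZero⁻¹)
open import Data.Nat.Properties using (+-comm)
open import Data.Nat.Divisibility using (_∣_; ∣-refl; ∣1⇒≡1; ∣m+n∣m⇒∣n)
open import Data.Nat.GCD using (gcd; gcd[m,n]∣m; gcd[m,n]∣n; gcd-greatest; gcd-zeroʳ)
open import Data.Nat.ListAction using (product)
open import Data.Nat.ListAction.Properties using (∈⇒∣product)
open import Data.Nat.Primality
  using (Prime; ¬prime[1]; prime?; prime⇒nonZero; prime⇒irreducible; productOfPrimes≥1)
open import Data.Nat.Primality.Factorisation using (factorise)
open import Data.Product using (_×_; _,_; ∃; proj₁)
open import Data.Sum using (inj₁; inj₂)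
open import Relation.Binary.PropositionalEquality using (_≡_; refl; sym; subst)

prime⇒pos : ∀ {p} → Prime p → 1 ≤ p
prime⇒pos {p} pp = >-nonZero⁻¹ p ⦃ prime⇒nonZero pp ⦄

prime∤1 : ∀ {p} → Prime p → p ∣ 1 → ⊥
prime∤1 pp p∣1 = ¬prime[1] (subst Prime (∣1⇒≡1 p∣1) pp)

prime∣⇒gcd≢1 : ∀ {n p} → Prime p → p ∣ n → gcd n p ≡ 1 → ⊥
prime∣⇒gcd≢1 pp p∣n gcd≡1 = prime∤1 pp (subst (_ ∣_) gcd≡1 (gcd-greatest p∣n ∣-refl))

prime∣suc⇒gcd≡1 : ∀ {n p} → Prime p → p ∣ suc n → gcd n p ≡ 1
prime∣suc⇒gcd≡1 {n} {p} pp p∣1+n with prime⇒irreducible pp (gcd[m,n]∣n n p)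
... | inj₁ gcd≡1 = gcd≡1
... | inj₂ gcd≡p = ⊥-elim (prime∤1 pp (∣m+n∣m⇒∣n (subst (p ∣_) (+-comm 1 n) p∣1+n) p∣n))
  where
  p∣n : p ∣ n
  p∣n = subst (_∣ n) gcd≡p (gcd[m,n]∣m n p)

prime-divisor : ∀ n → 2 ≤ n → ∃ λ p → Prime p × p ∣ n
prime-divisor (suc zero) (s≤s ())
prime-divisor (suc (suc k)) _ with factorise (suc (suc k))
... | record { factors = [] ; isFactorisation = () }
... | record { factors = p ∷ ps ; isFactorisation = n≡∏ ; factorsPrime = pp ∷ _ } =
  p , pp , subst (p ∣_) (sym n≡∏) (∈⇒∣product {ns = p ∷ ps} (here refl))

σ-isOpen : ∀ {n} → 1 ≤ n → IsOpen (σ n)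
σ-isOpen {n} 1≤n = proj₁ , λ σnx → n , 1≤n , σnx , λ σny → σny

σ-hasPrime : ∀ {n} → 1 ≤ n → ∃ λ p → σ n p × Prime p
σ-hasPrime {n} 1≤n with prime-divisor (suc n) (s≤s 1≤n)
... | p , pp , p∣1+n = p , (prime⇒pos pp , prime∣suc⇒gcd≡1 pp p∣1+n) , pp

𝐏-dense : Dense 𝐏
𝐏-dense = prime⇒pos , λ U (_ , U-basic) (_ , Ux) →
  let n , 1≤n , _ , σn⊆U = U-basic Ux
      p , σnp , pp = σ-hasPrime 1≤n
  in p , σn⊆U σnp , pp

dense⇒σ-meets : ∀ {A n} → Dense A → 1 ≤ n → ∃ λ x → σ n x × A x
dense⇒σ-meets {n = n} (_ , meets) 1≤n = meets (σ n) (σ-isOpen 1≤n) (1 , s≤s z≤n , gcd-zeroʳ n)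

dense⇒infinite : Dense 𝐏 → Infinite 𝐏
dense⇒infinite dense (xs , 𝐏⊆xs)
  with dense⇒σ-meets dense (productOfPrimes≥1 (all-filter prime? xs))
... | p , (_ , gcd[∏ps,p]≡1) , pp = prime∣⇒gcd≢1 pp p∣∏ps gcd[∏ps,p]≡1
  where
  p∣∏ps : p ∣ product (filter prime? xs)
  p∣∏ps = ∈⇒∣product (∈-filter⁺ prime? (𝐏⊆xs pp) pp)

mainTheorem1 : (Infinite 𝐏 → Dense 𝐏) × (Dense 𝐏 → Infinite 𝐏)
mainTheorem1 = (λ _ → 𝐏-dense) , dense⇒infinite
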